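{- Let $q=2mn+1$ be a prime power, where $m,n$ are odd and coprime positive integers. Let $\xi\in\mathbb{F}_q^*$ have order $n$, $\epsilon\in\mathbb{F}_q^*$ have order $m$, let $A_{m,n}=(a_{i,j})$ be the $m\times n$ array with $a_{i,j}=\epsilon^{i-1}\xi^{j-1}$, and let $\Pi_{m,n}$ be the Archdeacon embedding of $K_q$ induced by $A_{m,n}$ with the natural orderings $\omega_r$ (rows left to right) and $\omega_c$ (columns top to bottom). Then the group $\mathrm{Aut}_0^+(\Pi_{m,n})$ of orientation-preserving automorphisms of $\Pi_{m,n}$ fixing the vertex $0$ is isomorphic to $\mathbb{Z}_{mn}$.
   Context: $A_{m,n}$ is a Heffter array over the additive group of $\mathbb{F}_q$ (every row and column sums to $0$, and $\{\pm x\}$ over entries $x$ covers $\mathbb{F}_q\setminus\{0\}$ exactly once), and the natural orderings are compatible. Here $\omega_r(a_{i,j})=a_{i,j+1}$, $\omega_c(a_{i,j})=a_{i+1,j}$ (indices modulo $n$ and $m$ respectively); writing $\mathcal{E}(A)$ for the set of entries, $\rho_0$ is the permutation of $\mathbb{F}_q\setminus\{0\}$ with $\rho_0(a)=-\omega_r(a)$ for $a\in\mathcal{E}(A)$ and $\rho_0(a)=\omega_c(-a)$ for $a\in-\mathcal{E}(A)$, and the Archdeacon embedding is $\Pi_{m,n}=(K_q,\rho)$ where $K_q$ has vertex set $\mathbb{F}_q$ and $\rho((x,x+a))=(x,x+\rho_0(a))$ on oriented edges. An automorphism of a combinatorial embedding $(\Gamma,\rho)$ is a graph automorphism $\sigma$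 of $\Gamma$ (acting on oriented edges) such that either $\sigma\circ\rho=\rho\circ\sigma$ on all oriented edges (orientation-preserving) or $\sigma\circ\rho=\rho^{ -1}\circ\sigma$ on all oriented edges (orientation-reversing). -}

module Defs where

open import Level using (0ℓ)
open import Data.Nat as ℕ using (ℕ; zero; suc; NonZero)
open import Data.Nat.DivMod using (_%_; m%n<n)
open import Data.Nat.Primality using (Prime)
open import Data.Fin as Fin using (Fin; toℕ; fromℕ<)
open import Data.Fin.Properties using (any?)
open import Data.Product using (Σ; ∃; _×_; _,_)
open import Relation.Nullary using (¬_; Dec; yes; no)
open import Relation.Binary.PropositionalEquality using (_≡_)
open import Relation.Binary.Definitions using (DecidableEquality)
open import Algebra.Structures using (IsCommutativeRing)
open import Function.Bundles using (_↔_)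
open import Function.Definitions using (Bijective)

IsPrimePower : ℕ → Set
IsPrimePower q = Σ ℕ λ p → Σ ℕ λ k → Prime p × (0 ℕ.< k) × (q ≡ p ℕ.^ k)

record FiniteField (q : ℕ) : Set₁ where
  field
    Carrier : Set
    _+_ _*_ : Carrier → Carrier → Carrier
    -_      : Carrier → Carrier
    0# 1#   : Carrier
    isCommutativeRing : IsCommutativeRing _≡_ _+_ _*_ -_ 0# 1#
    0≢1     : ¬ (0# ≡ 1#)
    inverse : ∀ x → ¬ (x ≡ 0#) → Σ Carrier λ y → x * y ≡ 1#
    _≟_     : DecidableEquality Carrier
    enum    : Carrier ↔ Fin q

  infixl 7 _*_
  infixl 6 _+_
  infix  8 -_

  _-_ : Carrier → Carrier → Carrier
  x - y = x + (- y)

  _^_ : Carrier → ℕ → Carrier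
  x ^ zero  = 1#
  x ^ suc k = x * (x ^ k)

  HasOrder : Carrier → ℕ → Set
  HasOrder x k = (0 ℕ.< k) × (x ^ k ≡ 1#) × (∀ j → 0 ℕ.< j → j ℕ.< k → ¬ (x ^ j ≡ 1#))

  ∑ : ∀ {k} → (Fin k → Carrier) → Carrier
  ∑ {zero}  f = 0#
  ∑ {suc k} f = f Fin.zero + ∑ (λ i → f (Fin.suc i))

nextFin : ∀ {k} → Fin k → Fin k
nextFin {suc k} i = fromℕ< (m%n<n (suc (toℕ i)) (suc k))

_+ₘ_ : ∀ {N} → Fin N → Fin N → Fin N
_+ₘ_ {suc k} a b = fromℕ< (m%n<n (toℕ a ℕ.+ toℕ b) (suc k))

module Archdeacon {q : ℕ} (F : FiniteField q) (m n : ℕ) (ε ξ : FiniteField.Carrier F) where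
  open FiniteField F

  -- the array A_{m,n}: a_{i,j} = ε^(i-1) ξ^(j-1), with 0-based indices i : Fin m, j : Fin n
  a : Fin m → Fin n → Carrier
  a i j = (ε ^ toℕ i) * (ξ ^ toℕ j)

  RowsColsSumZero : Set
  RowsColsSumZero = (∀ i → ∑ (λ j → a i j) ≡ 0#) × (∀ j → ∑ (λ i → a i j) ≡ 0#)

  -- natural orderings: ω_r(a_{i,j}) = a_{i,j+1}, ω_c(a_{i,j}) = a_{i+1,j} (cyclically)
  -- ρ₀(x) = -ω_r(x) for x ∈ E(A), ρ₀(x) = ω_c(-x) for x ∈ -E(A).
  -- (The entries are located by search; the final fallback is never reached for
  --  x ≠ 0 since ±E(A) partitions F_q \ {0}.)
  ρ₀ : Carrier → Carrier
  ρ₀ x with any? (λ i → any? (λ j → x ≟ a i j))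
  ... | yes (i , j , _) = - a i (nextFin j)
  ... | no _ with any? (λ i → any? (λ j → (- x) ≟ a i j))
  ...   | yes (i , j , _) = a (nextFin i) j
  ...   | no _ = x

  -- σ (a vertex permutation of K_q, acting on oriented edges (x,y) ↦ (σx,σy))
  -- commutes with ρ, where ρ((x, x + d)) = (x, x + ρ₀ d).
  -- Both sides have first component σ x, so only the second component is compared.
  OrientationPreserving : (Carrier → Carrier) → Set
  OrientationPreserving σ =
    ∀ x y → ¬ (x ≡ y) → σ x + ρ₀ (σ y - σ x) ≡ σ (x + ρ₀ (y - x))

  -- elements of Aut₀⁺(Π_{m,n}): automorphisms of K_q (bijections of the vertex set)
  -- which are orientation-preserving for Π_{m,n} and fix the vertex 0
  IsAut₀⁺ : (Carrier → Carrier) → Set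
  IsAut₀⁺ σ = Bijective _≡_ _≡_ σ × OrientationPreserving σ × (σ 0# ≡ 0#)

  -- Aut₀⁺(Π_{m,n}) ≅ ℤ_N (group under composition): an isomorphism
  -- φ : ℤ_N → Aut₀⁺, bijective onto Aut₀⁺ (maps equal extensionally), homomorphic.
  Aut₀⁺≅ℤ : (N : ℕ) → Set
  Aut₀⁺≅ℤ N = Σ (Fin N → Carrier → Carrier) λ φ →
      (∀ k → IsAut₀⁺ (φ k))
    × (∀ k l → (∀ x → φ k x ≡ φ l x) → k ≡ l)
    × (∀ σ → IsAut₀⁺ σ → Σ (Fin N) λ k → ∀ x → φ k x ≡ σ x)
    × (∀ k l x → φ (k +ₘ l) x ≡ φ k (φ l x))

-- Put g = εξ. As m and n are coprime, g has order N = mn, and the entries ε^i ξ^j of A_{m,n}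
-- are exactly the powers of g. Since q = 2N + 1 with N odd, −1 is not a power of g, so the
-- 2N + 1 elements 0, ±g^k exhaust F_q. Reading ρ₀ off the array gives ρ₀(v) = −ξv and
-- ρ₀(−v) = εv for v ∈ ⟨g⟩; hence ρ₀ commutes with multiplication by ⟨g⟩, ρ₀ ∘ ρ₀ is
-- multiplication by g, and every x ↦ g^k x lies in Aut₀⁺. Conversely an orientation-preserving
-- σ fixing 0 commutes with ρ₀ (look at the edges leaving 0), hence with multiplication by g, so
-- σ(g^k) = g^k σ(1). If σ(1) ∈ ⟨g⟩, σ is multiplication by σ(1). If σ(1) ∈ −⟨g⟩, choose d with
-- d, 1 + d ∈ ⟨g⟩ (they exist since ∑ g^k = 0 while N ≠ 0 in F_q); orientation at the edge from
-- 1 to 1 + d then forces ε = ξ, which is impossible unless m = 1.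

module Submission where

open import Defs
open import Level using (0ℓ)
open import Data.Nat as ℕ using (ℕ; zero; suc; NonZero)
import Data.Nat.Properties as ℕ
open import Data.Nat.DivMod using (_%_; _/_; m≡m%n+[m/n]*n; m%n<n)
open import Data.Nat.Divisibility
  using (_∣_; ∣-refl; divides; m%n≡0⇒n∣m; n∣m*n; m∣m*n; ∣⇒≤; ∣1⇒≡1)
open import Data.Nat.Coprimality using (Coprime; coprime-Bézout; coprime-divisor)
open import Data.Nat.GCD using (module Bézout)
open import Data.Fin as Fin using (Fin; toℕ; fromℕ<)
open import Data.Fin.Properties
  using (any?; punchOut-injective; injective⇒≤; toℕ-fromℕ<; toℕ<n; toℕ-injective; join-splitAt)
open import Data.Fin.Permutation using (permutation)
open import Data.Sum using (_⊎_; inj₁; inj₂; [_,_])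
open import Data.Nat.Primality using (euclidsLemma; prime[2])
open import Data.Product using (Σ; ∃; _×_; _,_; proj₁; proj₂)
open import Function using (Inverse; Injection; _∘_)
open import Function.Properties.Inverse using (↔⇒↣)
open import Function.Definitions using (Injective)
open import Relation.Nullary using (¬_; yes; no; contradiction)
open import Relation.Binary.PropositionalEquality
  using (_≡_; refl; sym; trans; cong; cong₂; subst; module ≡-Reasoning)
open import Relation.Binary.Definitions using (tri<; tri≈; tri>)
open import Algebra.Bundles using (CommutativeRing)
open import Algebra.Structures using (IsCommutativeRing)
import Algebra.Properties.Ring as RingProperties
import Algebra.Properties.CommutativeSemiring.Exp as ExpProperties
import Algebra.Properties.Semiring.Sum as SumProperties
import Algebra.Properties.Monoid.Mult as MultProperties
import Algebra.Properties.CommutativeSemigroup as CommutativeSemigroupProperties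

Fin-injective⇒surjective : ∀ {k} (f : Fin k → Fin k) → Injective _≡_ _≡_ f →
                           ∀ y → ∃ λ x → f x ≡ y
Fin-injective⇒surjective f f-inj y with any? (λ x → f x Fin.≟ y)
... | yes hit = hit
Fin-injective⇒surjective {suc k} f f-inj y | no miss =
  contradiction (injective⇒≤ punchOut∘f-injective) ℕ.1+n≰n
  where
  f≢y : ∀ x → ¬ f x ≡ y
  f≢y x fx≡y = miss (x , fx≡y)
  punchOut∘f : Fin (suc k) → Fin k
  punchOut∘f x = Fin.punchOut (f≢y x ∘ sym)
  punchOut∘f-injective : Injective _≡_ _≡_ punchOut∘f
  punchOut∘f-injective = f-inj ∘ punchOut-injective (f≢y _ ∘ sym) (f≢y _ ∘ sym)

odd*odd : ∀ {m n} → ¬ 2 ∣ m → ¬ 2 ∣ n → ¬ 2 ∣ m ℕ.* n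
odd*odd {m} {n} 2∤m 2∤n = [ 2∤m , 2∤n ] ∘ euclidsLemma m n prime[2]

coprime⇒*-∣ : ∀ {m n k} → Coprime m n → m ∣ k → n ∣ k → m ℕ.* n ∣ k
coprime⇒*-∣ {m} {n} m⊥n m∣k (divides t refl)
  with divides s refl ← coprime-divisor m⊥n (subst (m ∣_) (ℕ.*-comm t n) m∣k)
  = divides s (ℕ.*-assoc s m n)

-- Arithmetic in a finite field

module FieldProperties {q : ℕ} (F : FiniteField q) where
  open FiniteField F public
  open IsCommutativeRing isCommutativeRing public
    using (+-identityˡ; +-identityʳ; -‿inverseʳ; *-assoc; *-comm; *-identityˡ; *-identityʳ;
           distribˡ; distribʳ; zeroˡ; zeroʳ)

  ring : CommutativeRing 0ℓ 0ℓ
  ring = record { isCommutativeRing = isCommutativeRing }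

  open RingProperties (CommutativeRing.ring ring) public
    using (xyx⁻¹≈y; -‿distribˡ-*; -‿distribʳ-*; -‿involutive; -‿injective; -1*x≈-x; -0#≈0#;
           +-cancelˡ; +-cancelʳ; +-inverseʳ-unique; x∙y⁻¹≈ε⇒x≈y; x[y-z]≈xy-xz)
  private
    module Exp = ExpProperties (CommutativeRing.commutativeSemiring ring)
  open SumProperties (CommutativeRing.semiring ring) public
    using (sum; sum-cong-≗; sum-replicate; ∑-distrib-+; ∑-permute; *-distribˡ-sum)
  open CommutativeSemigroupProperties (CommutativeRing.*-commutativeSemigroup ring) public
    using (x∙yz≈y∙xz)
  open MultProperties (CommutativeRing.+-monoid ring) public using (×-assocˡ) renaming (_×_ to _·_)

  open ≡-Reasoning

  *-cancelˡ : ∀ {x y z} → ¬ x ≡ 0# → x * y ≡ x * z → y ≡ z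
  *-cancelˡ {x} {y} {z} x≢0 xy≡xz = begin
    y             ≡⟨ sym (*-identityˡ y) ⟩
    1# * y        ≡⟨ cong (_* y) (trans (sym x*x⁻¹≡1) (*-comm x x⁻¹)) ⟩
    (x⁻¹ * x) * y ≡⟨ *-assoc x⁻¹ x y ⟩
    x⁻¹ * (x * y) ≡⟨ cong (x⁻¹ *_) xy≡xz ⟩
    x⁻¹ * (x * z) ≡⟨ sym (*-assoc x⁻¹ x z) ⟩
    (x⁻¹ * x) * z ≡⟨ cong (_* z) (trans (*-comm x⁻¹ x) x*x⁻¹≡1) ⟩
    1# * z        ≡⟨ *-identityˡ z ⟩
    z             ∎
    where
    x⁻¹ = proj₁ (inverse x x≢0)
    x*x⁻¹≡1 = proj₂ (inverse x x≢0)

  *-cancelʳ : ∀ {x y z} → ¬ x ≡ 0# → y * x ≡ z * x → y ≡ z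
  *-cancelʳ {x} {y} {z} x≢0 yx≡zx = *-cancelˡ x≢0 (trans (*-comm x y) (trans yx≡zx (*-comm z x)))

  *-nonzero : ∀ {x y} → ¬ x ≡ 0# → ¬ y ≡ 0# → ¬ x * y ≡ 0#
  *-nonzero {x} x≢0 y≢0 xy≡0 = y≢0 (*-cancelˡ x≢0 (trans xy≡0 (sym (zeroʳ x))))

  -‿nonzero : ∀ {x} → ¬ x ≡ 0# → ¬ - x ≡ 0#
  -‿nonzero {x} x≢0 -x≡0 = x≢0 (trans (sym (-‿involutive x)) (trans (cong -_ -x≡0) -0#≈0#))

  x-0≡x : ∀ x → x - 0# ≡ x
  x-0≡x x = trans (cong (x +_) -0#≈0#) (+-identityʳ x)

  x-y≡0⇒x≡y : ∀ {x y} → x - y ≡ 0# → x ≡ y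
  x-y≡0⇒x≡y = x∙y⁻¹≈ε⇒x≈y _ _

  a-x≡a-y⇒x≡y : ∀ {a x y} → a - x ≡ a - y → x ≡ y
  a-x≡a-y⇒x≡y {a} eq = -‿injective (+-cancelˡ a _ _ eq)

  -x*-y≡x*y : ∀ x y → - x * - y ≡ x * y
  -x*-y≡x*y x y = begin
    - x * - y     ≡⟨ sym (-‿distribˡ-* x (- y)) ⟩
    - (x * - y)   ≡⟨ cong -_ (sym (-‿distribʳ-* x y)) ⟩
    - - (x * y)   ≡⟨ -‿involutive _ ⟩
    x * y         ∎

  x[1-yd]≡y[1-xd]⇒x≡y : ∀ {x y d} → x * (1# - (y * d)) ≡ y * (1# - (x * d)) → x ≡ y
  x[1-yd]≡y[1-xd]⇒x≡y {x} {y} {d} eq = begin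
    x       ≡⟨ sym (*-identityʳ x) ⟩
    x * 1#  ≡⟨ +-cancelʳ (- (x * (y * d))) _ _ (begin
      (x * 1#) - (x * (y * d)) ≡⟨ sym (x[y-z]≈xy-xz x 1# (y * d)) ⟩
      x * (1# - (y * d))       ≡⟨ eq ⟩
      y * (1# - (x * d))       ≡⟨ x[y-z]≈xy-xz y 1# (x * d) ⟩
      (y * 1#) - (y * (x * d)) ≡⟨ cong (λ t → (y * 1#) - t) (x∙yz≈y∙xz y x d) ⟩
      (y * 1#) - (x * (y * d)) ∎) ⟩
    y * 1#  ≡⟨ *-identityʳ y ⟩
    y       ∎

  ^≗^ᴿ : ∀ x k → x ^ k ≡ x Exp.^ k
  ^≗^ᴿ x zero    = refl
  ^≗^ᴿ x (suc k) = cong (x *_) (^≗^ᴿ x k)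

  ^-homo-* : ∀ x a b → x ^ (a ℕ.+ b) ≡ x ^ a * x ^ b
  ^-homo-* x a b = begin
    x ^ (a ℕ.+ b)         ≡⟨ ^≗^ᴿ x (a ℕ.+ b) ⟩
    x Exp.^ (a ℕ.+ b)     ≡⟨ Exp.^-homo-* x a b ⟩
    x Exp.^ a * x Exp.^ b ≡⟨ sym (cong₂ _*_ (^≗^ᴿ x a) (^≗^ᴿ x b)) ⟩
    x ^ a * x ^ b         ∎

  ^-assocʳ : ∀ x a b → (x ^ a) ^ b ≡ x ^ (a ℕ.* b)
  ^-assocʳ x a b = begin
    (x ^ a) ^ b         ≡⟨ ^≗^ᴿ (x ^ a) b ⟩
    (x ^ a) Exp.^ b     ≡⟨ cong (Exp._^ b) (^≗^ᴿ x a) ⟩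
    (x Exp.^ a) Exp.^ b ≡⟨ Exp.^-assocʳ x a b ⟩
    x Exp.^ (a ℕ.* b)   ≡⟨ sym (^≗^ᴿ x (a ℕ.* b)) ⟩
    x ^ (a ℕ.* b)       ∎

  ^-distrib-* : ∀ x y k → (x * y) ^ k ≡ x ^ k * y ^ k
  ^-distrib-* x y k = begin
    (x * y) ^ k           ≡⟨ ^≗^ᴿ (x * y) k ⟩
    (x * y) Exp.^ k       ≡⟨ Exp.^-distrib-* x y k ⟩
    x Exp.^ k * y Exp.^ k ≡⟨ sym (cong₂ _*_ (^≗^ᴿ x k) (^≗^ᴿ y k)) ⟩
    x ^ k * y ^ k         ∎

  1^k≡1 : ∀ k → 1# ^ k ≡ 1#
  1^k≡1 zero    = refl
  1^k≡1 (suc k) = trans (*-identityˡ _) (1^k≡1 k)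

  ^-comm : ∀ x a b → (x ^ a) ^ b ≡ (x ^ b) ^ a
  ^-comm x a b = trans (^-assocʳ x a b) (trans (cong (x ^_) (ℕ.*-comm a b)) (sym (^-assocʳ x b a)))

  ^-nonzero : ∀ {x} k → ¬ x ≡ 0# → ¬ x ^ k ≡ 0#
  ^-nonzero zero    x≢0 = 0≢1 ∘ sym
  ^-nonzero (suc k) x≢0 = *-nonzero x≢0 (^-nonzero k x≢0)

  ^-∣ : ∀ x k {a} → x ^ k ≡ 1# → k ∣ a → x ^ a ≡ 1#
  ^-∣ x k x^k≡1 (divides t refl) = begin
    x ^ (t ℕ.* k) ≡⟨ cong (x ^_) (ℕ.*-comm t k) ⟩
    x ^ (k ℕ.* t) ≡⟨ sym (^-assocʳ x k t) ⟩
    (x ^ k) ^ t   ≡⟨ cong (_^ t) x^k≡1 ⟩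
    1# ^ t        ≡⟨ 1^k≡1 t ⟩
    1#            ∎

  ^-% : ∀ {x} k .{{_ : NonZero k}} a → x ^ k ≡ 1# → x ^ (a % k) ≡ x ^ a
  ^-% {x} k a x^k≡1 = sym (begin
    x ^ a                           ≡⟨ cong (x ^_) (m≡m%n+[m/n]*n a k) ⟩
    x ^ (a % k ℕ.+ a / k ℕ.* k)     ≡⟨ ^-homo-* x (a % k) _ ⟩
    x ^ (a % k) * x ^ (a / k ℕ.* k) ≡⟨ cong (x ^ (a % k) *_) (^-∣ x k x^k≡1 (n∣m*n (a / k))) ⟩
    x ^ (a % k) * 1#                ≡⟨ *-identityʳ _ ⟩
    x ^ (a % k)                     ∎)

  ^-toFin : ∀ x K .{{_ : NonZero K}} → x ^ K ≡ 1# → ∀ a → x ^ toℕ (fromℕ< (m%n<n a K)) ≡ x ^ a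
  ^-toFin x K x^K≡1 a = trans (cong (x ^_) (toℕ-fromℕ< (m%n<n a K))) (^-% K a x^K≡1)

  ^-nextFin : ∀ x {K} → x ^ K ≡ 1# → (j : Fin K) → x ^ toℕ (nextFin j) ≡ x * x ^ toℕ j
  ^-nextFin x {suc K} x^K≡1 j = ^-toFin x (suc K) x^K≡1 (suc (toℕ j))

  ^-+ₘ : ∀ x {K} → x ^ K ≡ 1# → (k l : Fin K) → x ^ toℕ (k +ₘ l) ≡ x ^ toℕ k * x ^ toℕ l
  ^-+ₘ x {suc K} x^K≡1 k l =
    trans (^-toFin x (suc K) x^K≡1 (toℕ k ℕ.+ toℕ l)) (^-homo-* x (toℕ k) (toℕ l))

  -1^odd : ∀ {k} → ¬ 2 ∣ k → (- 1#) ^ k ≡ - 1#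
  -1^odd {k} 2∤k with k % 2 in k%2≡r | m%n<n k 2
  ... | 0           | _ = contradiction (m%n≡0⇒n∣m k 2 k%2≡r) 2∤k
  ... | 1           | _ = begin
    (- 1#) ^ k                    ≡⟨ cong ((- 1#) ^_) k≡1+[k/2]*2 ⟩
    - 1# * (- 1#) ^ (k / 2 ℕ.* 2) ≡⟨ cong (- 1# *_) (^-∣ (- 1#) 2 [-1]^2≡1 (n∣m*n (k / 2))) ⟩
    - 1# * 1#                     ≡⟨ *-identityʳ _ ⟩
    - 1#                          ∎
    where
    k≡1+[k/2]*2 : k ≡ suc (k / 2 ℕ.* 2)
    k≡1+[k/2]*2 = trans (m≡m%n+[m/n]*n k 2) (cong (ℕ._+ k / 2 ℕ.* 2) k%2≡r)
    [-1]^2≡1 : (- 1#) ^ 2 ≡ 1#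
    [-1]^2≡1 = trans (cong (- 1# *_) (*-identityʳ _)) (trans (-1*x≈-x _) (-‿involutive 1#))
  ... | suc (suc _) | ℕ.s≤s (ℕ.s≤s ())

  -‿^-odd : ∀ x {k} → ¬ 2 ∣ k → (- x) ^ k ≡ - x ^ k
  -‿^-odd x {k} 2∤k = begin
    (- x) ^ k          ≡⟨ cong (_^ k) (sym (-1*x≈-x x)) ⟩
    (- 1# * x) ^ k     ≡⟨ ^-distrib-* (- 1#) x k ⟩
    (- 1#) ^ k * x ^ k ≡⟨ cong (_* x ^ k) (-1^odd 2∤k) ⟩
    - 1# * x ^ k       ≡⟨ -1*x≈-x _ ⟩
    - x ^ k            ∎

  HasOrder⇒∣ : ∀ {x k a} → HasOrder x k → x ^ a ≡ 1# → k ∣ a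
  HasOrder⇒∣ {x} {suc k} {a} (_ , x^k≡1 , minimal) x^a≡1 with a % suc k in a%k≡r
  ... | zero  = m%n≡0⇒n∣m a (suc k) a%k≡r
  ... | suc r = contradiction x^r≡1 (minimal (suc r) (ℕ.s≤s ℕ.z≤n) r<k)
    where
    r<k = subst (ℕ._< suc k) a%k≡r (m%n<n a (suc k))
    x^r≡1 = trans (subst (λ t → x ^ t ≡ x ^ a) a%k≡r (^-% (suc k) a x^k≡1)) x^a≡1

  x^b≡1⇒x^[1+b]≡1⇒x≡1 : ∀ {x} b → x ^ b ≡ 1# → x ^ suc b ≡ 1# → x ≡ 1#
  x^b≡1⇒x^[1+b]≡1⇒x≡1 {x} b x^b≡1 x^[1+b]≡1 =
    trans (sym (*-identityʳ x)) (trans (cong (x *_) (sym x^b≡1)) x^[1+b]≡1)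

  ^≡1-coprime : ∀ {x m n} → Coprime m n → x ^ m ≡ 1# → x ^ n ≡ 1# → x ≡ 1#
  ^≡1-coprime {x} m⊥n x^m≡1 x^n≡1 with coprime-Bézout m⊥n
  ... | Bézout.+- s t 1+tn≡sm = x^b≡1⇒x^[1+b]≡1⇒x≡1 (t ℕ.* _) (^-∣ x _ x^n≡1 (n∣m*n t))
          (subst (λ c → x ^ c ≡ 1#) (sym 1+tn≡sm) (^-∣ x _ x^m≡1 (n∣m*n s)))
  ... | Bézout.-+ s t 1+sm≡tn = x^b≡1⇒x^[1+b]≡1⇒x≡1 (s ℕ.* _) (^-∣ x _ x^m≡1 (n∣m*n s))
          (subst (λ c → x ^ c ≡ 1#) (sym 1+sm≡tn) (^-∣ x _ x^n≡1 (n∣m*n t)))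

  root-^ : ∀ x k → x ^ k ≡ 1# → ∀ j → (x ^ j) ^ k ≡ 1#
  root-^ x k x^k≡1 j = trans (^-comm x j k) (trans (cong (_^ j) x^k≡1) (1^k≡1 j))

  root-* : ∀ x y k → x ^ k ≡ 1# → y ^ k ≡ 1# → (x * y) ^ k ≡ 1#
  root-* x y k x^k≡1 y^k≡1 =
    trans (^-distrib-* x y k) (trans (cong₂ _*_ x^k≡1 y^k≡1) (*-identityˡ 1#))

  HasOrder-* : ∀ {x y m n} → Coprime m n → HasOrder x m → HasOrder y n →
               HasOrder (x * y) (m ℕ.* n)
  HasOrder-* {x} {y} {m} {n} m⊥n ord-x@(0<m , x^m≡1 , _) ord-y@(0<n , y^n≡1 , _) =
    ℕ.*-mono-< 0<m 0<n ,
    root-* x y (m ℕ.* n) (^-∣ x m x^m≡1 (m∣m*n n)) (^-∣ y n y^n≡1 (n∣m*n m)) ,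
    λ j 0<j j<mn [xy]^j≡1 → ℕ.<⇒≱ j<mn (∣⇒≤ {{ℕ.>-nonZero 0<j}} (mn∣ j [xy]^j≡1))
    where
    mn∣ : ∀ j → (x * y) ^ j ≡ 1# → m ℕ.* n ∣ j
    mn∣ j [xy]^j≡1 = coprime⇒*-∣ m⊥n (HasOrder⇒∣ ord-x x^j≡1) (HasOrder⇒∣ ord-y y^j≡1)
      where
      x^j*y^j≡1 : x ^ j * y ^ j ≡ 1#
      x^j*y^j≡1 = trans (sym (^-distrib-* x y j)) [xy]^j≡1
      [x^j]^n≡1 : (x ^ j) ^ n ≡ 1#
      [x^j]^n≡1 = begin
        (x ^ j) ^ n                ≡⟨ sym (*-identityʳ _) ⟩
        (x ^ j) ^ n * 1#           ≡⟨ cong ((x ^ j) ^ n *_) (sym (root-^ y n y^n≡1 j)) ⟩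
        (x ^ j) ^ n * (y ^ j) ^ n  ≡⟨ sym (^-distrib-* (x ^ j) (y ^ j) n) ⟩
        (x ^ j * y ^ j) ^ n        ≡⟨ cong (_^ n) x^j*y^j≡1 ⟩
        1# ^ n                     ≡⟨ 1^k≡1 n ⟩
        1#                         ∎
      x^j≡1 : x ^ j ≡ 1#
      x^j≡1 = ^≡1-coprime m⊥n (root-^ x m x^m≡1 j) [x^j]^n≡1
      y^j≡1 : y ^ j ≡ 1#
      y^j≡1 = trans (sym (*-identityˡ _)) (trans (cong (_* y ^ j) (sym x^j≡1)) x^j*y^j≡1)

  sum-reindex : ∀ {k} (f : Fin k → Carrier) (π : Fin k → Fin k) → Injective _≡_ _≡_ π →
                sum (f ∘ π) ≡ sum f
  sum-reindex f π π-injective = sym (∑-permute f (permutation π π⁻¹ π∘π⁻¹ π⁻¹∘π))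
    where
    π⁻¹ = λ y → proj₁ (Fin-injective⇒surjective π π-injective y)
    π∘π⁻¹ = λ y → proj₂ (Fin-injective⇒surjective π π-injective y)
    π⁻¹∘π = λ x → π-injective (π∘π⁻¹ (π x))

  -‿sum : ∀ {k} (f : Fin k → Carrier) → sum (λ i → - f i) ≡ - sum f
  -‿sum f = begin
    sum (λ i → - f i)      ≡⟨ sum-cong-≗ (λ i → sym (-1*x≈-x (f i))) ⟩
    sum (λ i → - 1# * f i) ≡⟨ sym (*-distribˡ-sum (- 1#) f) ⟩
    - 1# * sum f           ≡⟨ -1*x≈-x (sum f) ⟩
    - sum f                ∎

  private
    module Enum = Inverse enum
    to-injective : Injective _≡_ _≡_ Enum.to
    to-injective = Injection.injective (↔⇒↣ enum)

  injective⇒surjective : ∀ {k} → q ≡ k → (h : Fin k → Carrier) → Injective _≡_ _≡_ h →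
                         ∀ x → ∃ λ i → h i ≡ x
  injective⇒surjective refl h h-injective x
    with i , hit ← Fin-injective⇒surjective (Enum.to ∘ h) (h-injective ∘ to-injective) (Enum.to x)
    = i , to-injective hit

  -- x ↦ x + 1 permutes F, so ∑ x = ∑ (x + 1) = ∑ x + q·1
  q·1≡0 : q · 1# ≡ 0#
  q·1≡0 = +-cancelˡ (sum elements) (q · 1#) 0# (begin
    sum elements + q · 1#             ≡⟨ cong (sum elements +_) (sym (sum-replicate q {1#})) ⟩
    sum elements + sum {q} (λ _ → 1#) ≡⟨ sym (∑-distrib-+ elements (λ _ → 1#)) ⟩
    sum shifted                       ≡⟨ sum-cong-≗ (sym ∘ Enum.strictlyInverseʳ ∘ shifted) ⟩
    sum (elements ∘ shift)            ≡⟨ sum-reindex elements shift shift-injective ⟩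
    sum elements                      ≡⟨ sym (+-identityʳ _) ⟩
    sum elements + 0#                 ∎)
    where
    elements = Enum.from
    shifted : Fin q → Carrier
    shifted i = elements i + 1#
    shift : Fin q → Fin q
    shift = Enum.to ∘ shifted
    shift-injective : Injective _≡_ _≡_ shift
    shift-injective {i} {j} eq =
      trans (sym (Enum.strictlyInverseˡ i))
        (trans (cong Enum.to (+-cancelʳ 1# _ _ (to-injective eq))) (Enum.strictlyInverseˡ j))

  module OddOrder {N : ℕ} (q≡1+2N : q ≡ suc (2 ℕ.* N)) where

    1+2·N·1≡0 : 1# + (N · 1# + N · 1#) ≡ 0#
    1+2·N·1≡0 = begin
      1# + (N · 1# + N · 1#) ≡⟨ cong (λ y → 1# + (N · 1# + y)) (sym (+-identityʳ _)) ⟩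
      1# + 2 · (N · 1#)      ≡⟨ cong (1# +_) (×-assocˡ 1# 2 N) ⟩
      suc (2 ℕ.* N) · 1#     ≡⟨ cong (_· 1#) (sym q≡1+2N) ⟩
      q · 1#                 ≡⟨ q·1≡0 ⟩
      0#                     ∎

    N·1≢0 : ¬ N · 1# ≡ 0#
    N·1≢0 N·1≡0 = 0≢1 (sym (begin
      1#                     ≡⟨ sym (+-identityʳ 1#) ⟩
      1# + 0#                ≡⟨ cong (1# +_) (sym (+-identityʳ 0#)) ⟩
      1# + (0# + 0#)         ≡⟨ cong (λ y → 1# + (y + y)) (sym N·1≡0) ⟩
      1# + (N · 1# + N · 1#) ≡⟨ 1+2·N·1≡0 ⟩
      0#                     ∎))

    -1≢1 : ¬ - 1# ≡ 1#
    -1≢1 -1≡1 = 0≢1 (sym (begin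
      1#                     ≡⟨ sym (+-identityʳ 1#) ⟩
      1# + 0#                ≡⟨ cong (1# +_) (sym y+y≡0) ⟩
      1# + (N · 1# + N · 1#) ≡⟨ 1+2·N·1≡0 ⟩
      0#                     ∎))
      where
      y = N · 1#
      y+y≡0 : y + y ≡ 0#
      y+y≡0 = begin
        y + y         ≡⟨ cong (y +_) (trans (sym (*-identityˡ y)) (cong (_* y) (sym -1≡1))) ⟩
        y + - 1# * y  ≡⟨ cong (y +_) (-1*x≈-x y) ⟩
        y - y         ≡⟨ -‿inverseʳ y ⟩
        0#            ∎

-- The cyclic subgroup generated by an element of order N

module CyclicSubgroup {q : ℕ} (F : FiniteField q) {g : FiniteField.Carrier F} {N : ℕ}
  (ord-g : FiniteField.HasOrder F g N) where
  open FieldProperties F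
  open ≡-Reasoning

  g^N≡1 : g ^ N ≡ 1#
  g^N≡1 = proj₁ (proj₂ ord-g)

  instance
    N≢0 : NonZero N
    N≢0 = ℕ.>-nonZero (proj₁ ord-g)

  infix 4 _∈⟨g⟩
  _∈⟨g⟩ : Carrier → Set
  x ∈⟨g⟩ = ∃ λ k → x ≡ g ^ k

  root⇒≢0 : ∀ {x} → x ^ N ≡ 1# → ¬ x ≡ 0#
  root⇒≢0 {x} x^N≡1 refl = 0≢1 (begin
    0#                          ≡⟨ sym (zeroˡ _) ⟩
    0# * 0# ^ ℕ.pred N          ≡⟨ cong (0# ^_) (ℕ.suc-pred N) ⟩
    0# ^ N                      ≡⟨ x^N≡1 ⟩
    1#                          ∎)

  g≢0 : ¬ g ≡ 0#
  g≢0 = root⇒≢0 g^N≡1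

  ∈⟨g⟩⇒≢0 : ∀ {x} → x ∈⟨g⟩ → ¬ x ≡ 0#
  ∈⟨g⟩⇒≢0 (k , refl) = ^-nonzero k g≢0

  ∈⟨g⟩-* : ∀ {x y} → x ∈⟨g⟩ → y ∈⟨g⟩ → x * y ∈⟨g⟩
  ∈⟨g⟩-* (k , refl) (l , refl) = k ℕ.+ l , sym (^-homo-* g k l)

  ∈⟨g⟩-^ : ∀ {x} k → x ∈⟨g⟩ → x ^ k ∈⟨g⟩
  ∈⟨g⟩-^ k (l , refl) = l ℕ.* k , ^-assocʳ g l k

  ∈⟨g⟩⇒root : ∀ {x} → x ∈⟨g⟩ → x ^ N ≡ 1#
  ∈⟨g⟩⇒root (k , refl) = root-^ g N g^N≡1 k

  ∈⟨g⟩-inverse : ∀ {x} → x ∈⟨g⟩ → ∃ λ w → w ∈⟨g⟩ × x * w ≡ 1#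
  ∈⟨g⟩-inverse {x} x∈ = x ^ ℕ.pred N , ∈⟨g⟩-^ (ℕ.pred N) x∈ ,
    trans (cong (x ^_) (ℕ.suc-pred N)) (∈⟨g⟩⇒root x∈)

  g^-distinct : ∀ {a b} → a ℕ.< b → b ℕ.< N → ¬ g ^ a ≡ g ^ b
  g^-distinct {a} {b} a<b b<N g^a≡g^b =
    minimal (b ℕ.∸ a) (ℕ.m<n⇒0<n∸m a<b) (ℕ.≤-<-trans (ℕ.m∸n≤m b a) b<N) g^[b∸a]≡1
    where
    minimal = proj₂ (proj₂ ord-g)
    g^[b∸a]≡1 : g ^ (b ℕ.∸ a) ≡ 1#
    g^[b∸a]≡1 = *-cancelˡ (^-nonzero a g≢0) (begin
      g ^ a * g ^ (b ℕ.∸ a)   ≡⟨ sym (^-homo-* g a (b ℕ.∸ a)) ⟩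
      g ^ (a ℕ.+ (b ℕ.∸ a))   ≡⟨ cong (g ^_) (ℕ.m+[n∸m]≡n (ℕ.<⇒≤ a<b)) ⟩
      g ^ b                   ≡⟨ sym g^a≡g^b ⟩
      g ^ a                   ≡⟨ sym (*-identityʳ _) ⟩
      g ^ a * 1#              ∎)

  g^-injective : ∀ {k l : Fin N} → g ^ toℕ k ≡ g ^ toℕ l → k ≡ l
  g^-injective {k} {l} g^k≡g^l with ℕ.<-cmp (toℕ k) (toℕ l)
  ... | tri< k<l _ _ = contradiction g^k≡g^l (g^-distinct k<l (toℕ<n l))
  ... | tri≈ _ k≡l _ = toℕ-injective k≡l
  ... | tri> _ _ l<k = contradiction (sym g^k≡g^l) (g^-distinct l<k (toℕ<n k))

  toFin : ℕ → Fin N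
  toFin a = fromℕ< (m%n<n a N)

  g^toFin : ∀ a → g ^ toℕ (toFin a) ≡ g ^ a
  g^toFin = ^-toFin g N g^N≡1

  ∑⟨g⟩ : Carrier
  ∑⟨g⟩ = sum (λ (k : Fin N) → g ^ toℕ k)

  ∑⟨g⟩≡0 : ¬ N ≡ 1 → ∑⟨g⟩ ≡ 0#
  ∑⟨g⟩≡0 N≢1 with ∑⟨g⟩ ≟ 0#
  ... | yes ∑≡0 = ∑≡0
  ... | no  ∑≢0 = contradiction (∣1⇒≡1 (HasOrder⇒∣ ord-g (trans (*-identityʳ g) g≡1))) N≢1
    where
    nextFin-injective : Injective _≡_ _≡_ (nextFin {N})
    nextFin-injective {k} {l} next≡ = g^-injective (*-cancelˡ g≢0 (begin
      g * g ^ toℕ k           ≡⟨ sym (^-nextFin g g^N≡1 k) ⟩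
      g ^ toℕ (nextFin k)     ≡⟨ cong (λ i → g ^ toℕ i) next≡ ⟩
      g ^ toℕ (nextFin l)     ≡⟨ ^-nextFin g g^N≡1 l ⟩
      g * g ^ toℕ l           ∎))
    g∑≡∑ : g * ∑⟨g⟩ ≡ ∑⟨g⟩
    g∑≡∑ = begin
      g * ∑⟨g⟩
        ≡⟨ *-distribˡ-sum g (λ (k : Fin N) → g ^ toℕ k) ⟩
      sum (λ (k : Fin N) → g * g ^ toℕ k)
        ≡⟨ sum-cong-≗ {N} (λ k → sym (^-nextFin g g^N≡1 k)) ⟩
      sum (λ (k : Fin N) → g ^ toℕ (nextFin k))
        ≡⟨ sum-reindex (λ k → g ^ toℕ k) nextFin nextFin-injective ⟩
      ∑⟨g⟩
        ∎
    g≡1 : g ≡ 1#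
    g≡1 = *-cancelʳ ∑≢0 (trans g∑≡∑ (sym (*-identityˡ ∑⟨g⟩)))

  module HalfOrder (q≡1+2N : q ≡ suc (2 ℕ.* N)) (N-odd : ¬ 2 ∣ N) where
    open OddOrder {N} q≡1+2N

    -‿not-root : ∀ {x} → x ^ N ≡ 1# → ¬ (- x) ^ N ≡ 1#
    -‿not-root {x} x^N≡1 [-x]^N≡1 = -1≢1 (begin
      - 1#      ≡⟨ cong -_ (sym x^N≡1) ⟩
      - x ^ N   ≡⟨ sym (-‿^-odd x N-odd) ⟩
      (- x) ^ N ≡⟨ [-x]^N≡1 ⟩
      1#        ∎)

    -‿∉⟨g⟩ : ∀ {x} → x ∈⟨g⟩ → ¬ - x ∈⟨g⟩
    -‿∉⟨g⟩ x∈ -x∈ = -‿not-root (∈⟨g⟩⇒root x∈) (∈⟨g⟩⇒root -x∈)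

    data Classification (x : Carrier) : Set where
      null     : x ≡ 0# → Classification x
      power    : ∀ k → x ≡ g ^ k → Classification x
      negPower : ∀ k → x ≡ - g ^ k → Classification x

    private
      signedPower : Fin N ⊎ Fin N → Carrier
      signedPower (inj₁ k) = g ^ toℕ k
      signedPower (inj₂ k) = - g ^ toℕ k

      signedPower≢0 : ∀ u → ¬ signedPower u ≡ 0#
      signedPower≢0 (inj₁ k) = ^-nonzero (toℕ k) g≢0
      signedPower≢0 (inj₂ k) = -‿nonzero (^-nonzero (toℕ k) g≢0)

      signedPower-injective : Injective _≡_ _≡_ signedPower
      signedPower-injective {inj₁ k} {inj₁ l} eq = cong inj₁ (g^-injective eq)
      signedPower-injective {inj₁ k} {inj₂ l} eq =
        contradiction (toℕ k , sym eq) (-‿∉⟨g⟩ (toℕ l , refl))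
      signedPower-injective {inj₂ k} {inj₁ l} eq =
        contradiction (toℕ l , eq) (-‿∉⟨g⟩ (toℕ k , refl))
      signedPower-injective {inj₂ k} {inj₂ l} eq = cong inj₂ (g^-injective (-‿injective eq))

      element : Fin (suc (N ℕ.+ N)) → Carrier
      element Fin.zero    = 0#
      element (Fin.suc i) = signedPower (Fin.splitAt N i)

      element-injective : Injective _≡_ _≡_ element
      element-injective {Fin.zero}  {Fin.zero}  _  = refl
      element-injective {Fin.zero}  {Fin.suc j} eq = contradiction (sym eq) (signedPower≢0 (Fin.splitAt N j))
      element-injective {Fin.suc i} {Fin.zero}  eq = contradiction eq (signedPower≢0 (Fin.splitAt N i))
      element-injective {Fin.suc i} {Fin.suc j} eq = cong Fin.suc (begin
        i                              ≡⟨ sym (join-splitAt N N i) ⟩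
        Fin.join N N (Fin.splitAt N i) ≡⟨ cong (Fin.join N N) splitᵢ≡splitⱼ ⟩
        Fin.join N N (Fin.splitAt N j) ≡⟨ join-splitAt N N j ⟩
        j                              ∎)
        where
        splitᵢ≡splitⱼ = signedPower-injective {Fin.splitAt N i} {Fin.splitAt N j} eq

      q≡1+N+N : q ≡ suc (N ℕ.+ N)
      q≡1+N+N = trans q≡1+2N (cong (λ k → suc (N ℕ.+ k)) (ℕ.+-identityʳ N))

    -- 0 and ±g^k (k < N) are 2N + 1 = q distinct elements, so they exhaust F
    classify : ∀ x → Classification x
    classify x with injective⇒surjective q≡1+N+N element element-injective x
    ... | Fin.zero  , 0≡x = null (sym 0≡x)
    ... | Fin.suc i , hit with Fin.splitAt N i
    ...   | inj₁ k = power (toℕ k) (sym hit)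
    ...   | inj₂ k = negPower (toℕ k) (sym hit)

    root⇒∈⟨g⟩ : ∀ {x} → x ^ N ≡ 1# → x ∈⟨g⟩
    root⇒∈⟨g⟩ {x} x^N≡1 with classify x
    ... | null x≡0            = contradiction x≡0 (root⇒≢0 x^N≡1)
    ... | power k x≡g^k       = k , x≡g^k
    ... | negPower k x≡-g^k   = contradiction [-x]^N≡1 (-‿not-root x^N≡1)
      where
      [-x]^N≡1 : (- x) ^ N ≡ 1#
      [-x]^N≡1 = ∈⟨g⟩⇒root (k , trans (cong -_ x≡-g^k) (-‿involutive _))

    -- Otherwise 1 + g^l = −g^(π l) for a permutation π of Fin N, and summing over l gives
    -- N·1 + ∑⟨g⟩ = −∑⟨g⟩, where ∑⟨g⟩ = 0.
    ∃[d]1+d∈⟨g⟩ : ¬ N ≡ 1 → ∃ λ d → d ∈⟨g⟩ × 1# + d ∈⟨g⟩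
    ∃[d]1+d∈⟨g⟩ N≢1 with any? (λ l → any? (λ r → (1# + g ^ toℕ l) ≟ (g ^ toℕ r)))
    ... | yes (l , r , 1+g^l≡g^r) = g ^ toℕ l , (toℕ l , refl) , (toℕ r , 1+g^l≡g^r)
    ... | no none = contradiction N·1≡0 N·1≢0
      where
      1+g^l∈-⟨g⟩ : ∀ l → ∃ λ r → 1# + g ^ toℕ l ≡ - g ^ toℕ r
      1+g^l∈-⟨g⟩ l with classify (1# + g ^ toℕ l)
      ... | null 1+g^l≡0 =
        contradiction (toℕ l , sym (+-inverseʳ-unique 1# _ 1+g^l≡0)) (-‿∉⟨g⟩ (0 , refl))
      ... | power r 1+g^l≡g^r = contradiction (l , toFin r , trans 1+g^l≡g^r (sym (g^toFin r))) none
      ... | negPower r 1+g^l≡-g^r = toFin r , trans 1+g^l≡-g^r (cong -_ (sym (g^toFin r)))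

      π : Fin N → Fin N
      π l = proj₁ (1+g^l∈-⟨g⟩ l)

      π-injective : Injective _≡_ _≡_ π
      π-injective {k} {l} πk≡πl = g^-injective (+-cancelˡ 1# _ _ (begin
        1# + g ^ toℕ k   ≡⟨ proj₂ (1+g^l∈-⟨g⟩ k) ⟩
        - g ^ toℕ (π k)  ≡⟨ cong (λ r → - g ^ toℕ r) πk≡πl ⟩
        - g ^ toℕ (π l)  ≡⟨ sym (proj₂ (1+g^l∈-⟨g⟩ l)) ⟩
        1# + g ^ toℕ l   ∎))

      N·1≡0 : N · 1# ≡ 0#
      N·1≡0 = begin
        N · 1#                               ≡⟨ sym (+-identityʳ _) ⟩
        N · 1# + 0#                          ≡⟨ cong₂ _+_ (sym (sum-replicate N)) (sym (∑⟨g⟩≡0 N≢1)) ⟩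
        sum {N} (λ _ → 1#) + ∑⟨g⟩            ≡⟨ sym (∑-distrib-+ {N} (λ _ → 1#) (λ k → g ^ toℕ k)) ⟩
        sum (λ (l : Fin N) → 1# + g ^ toℕ l) ≡⟨ sum-cong-≗ {N} (proj₂ ∘ 1+g^l∈-⟨g⟩) ⟩
        sum (λ l → - g ^ toℕ (π l))          ≡⟨ -‿sum (λ l → g ^ toℕ (π l)) ⟩
        - sum (λ l → g ^ toℕ (π l))          ≡⟨ cong -_ (sum-reindex (λ k → g ^ toℕ k) π π-injective) ⟩
        - ∑⟨g⟩                               ≡⟨ cong -_ (∑⟨g⟩≡0 N≢1) ⟩
        - 0#                                 ≡⟨ -0#≈0# ⟩
        0#                                   ∎


-- The Archdeacon embedding of A_{m,n}

columnSumZero⇒m≢1 : ∀ {q} (F : FiniteField q) {m n ε ξ} → 0 ℕ.< n →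
                    (∀ j → FiniteField.∑ F (λ i → Archdeacon.a F m n ε ξ i j) ≡ FiniteField.0# F) →
                    ¬ m ≡ 1
columnSumZero⇒m≢1 F (ℕ.s≤s ℕ.z≤n) column≡0 refl =
  0≢1 (trans (sym (column≡0 Fin.zero)) (trans (+-identityʳ _) (*-identityˡ 1#)))
  where open FieldProperties F

module ArchdeaconRotation {q : ℕ} (F : FiniteField q) (m n : ℕ) (ε ξ : FiniteField.Carrier F)
  (ε^m≡1 : FiniteField._^_ F ε m ≡ FiniteField.1# F)
  (ξ^n≡1 : FiniteField._^_ F ξ n ≡ FiniteField.1# F) where
  open FieldProperties F
  open Archdeacon F m n ε ξ
  open ≡-Reasoning

  infix 4 _∈E[A]
  _∈E[A] : Carrier → Set
  x ∈E[A] = Σ (Fin m) λ i → Σ (Fin n) λ j → x ≡ a i j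

  a-nextCol : ∀ i j → a i (nextFin j) ≡ ξ * a i j
  a-nextCol i j = begin
    ε ^ toℕ i * ξ ^ toℕ (nextFin j) ≡⟨ cong (ε ^ toℕ i *_) (^-nextFin ξ ξ^n≡1 j) ⟩
    ε ^ toℕ i * (ξ * ξ ^ toℕ j)     ≡⟨ sym (*-assoc _ ξ _) ⟩
    ε ^ toℕ i * ξ * ξ ^ toℕ j       ≡⟨ cong (_* ξ ^ toℕ j) (*-comm _ ξ) ⟩
    ξ * ε ^ toℕ i * ξ ^ toℕ j       ≡⟨ *-assoc ξ _ _ ⟩
    ξ * a i j                       ∎

  a-nextRow : ∀ i j → a (nextFin i) j ≡ ε * a i j
  a-nextRow i j = trans (cong (_* ξ ^ toℕ j) (^-nextFin ε ε^m≡1 i)) (*-assoc ε _ _)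

  ρ₀-entry : ∀ {x} → x ∈E[A] → ρ₀ x ≡ - (ξ * x)
  ρ₀-entry {x} x∈ with any? (λ i → any? (λ j → x ≟ a i j))
  ... | yes (i , j , x≡aij) = cong -_ (trans (a-nextCol i j) (cong (ξ *_) (sym x≡aij)))
  ... | no x∉ = contradiction x∈ x∉

  ρ₀-negEntry : ∀ {x} → ¬ x ∈E[A] → - x ∈E[A] → ρ₀ x ≡ ε * - x
  ρ₀-negEntry {x} x∉ -x∈ with any? (λ i → any? (λ j → x ≟ a i j))
  ... | yes x∈ = contradiction x∈ x∉
  ... | no _ with any? (λ i → any? (λ j → (- x) ≟ a i j))
  ...   | yes (i , j , -x≡aij) = trans (a-nextRow i j) (cong (ε *_) (sym -x≡aij))
  ...   | no -x∉ = contradiction -x∈ -x∉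

module CyclicArchdeacon {q : ℕ} (F : FiniteField q) {m n : ℕ} {ε ξ : FiniteField.Carrier F}
  (ord-ε : FiniteField.HasOrder F ε m) (ord-ξ : FiniteField.HasOrder F ξ n) (m⊥n : Coprime m n)
  (q≡1+2mn : q ≡ suc (2 ℕ.* (m ℕ.* n))) (mn-odd : ¬ 2 ∣ m ℕ.* n) (m≢1 : ¬ m ≡ 1) where
  open FieldProperties F
  open Archdeacon F m n ε ξ
  open ≡-Reasoning

  private
    0<m = proj₁ ord-ε
    0<n = proj₁ ord-ξ
    ε^m≡1 = proj₁ (proj₂ ord-ε)
    ξ^n≡1 = proj₁ (proj₂ ord-ξ)
    instance
      m≢0 : NonZero m
      m≢0 = ℕ.>-nonZero 0<m
      n≢0 : NonZero n
      n≢0 = ℕ.>-nonZero 0<n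

  open ArchdeaconRotation F m n ε ξ ε^m≡1 ξ^n≡1
  open CyclicSubgroup F (HasOrder-* m⊥n ord-ε ord-ξ)
  open HalfOrder q≡1+2mn mn-odd

  g : Carrier
  g = ε * ξ

  ε≢ξ : ¬ ε ≡ ξ
  ε≢ξ refl = m≢1 (m⊥n (∣-refl , HasOrder⇒∣ ord-ε ξ^n≡1))

  mn≢1 : ¬ m ℕ.* n ≡ 1
  mn≢1 = m≢1 ∘ ℕ.m*n≡1⇒m≡1 m n

  ε∈⟨g⟩ : ε ∈⟨g⟩
  ε∈⟨g⟩ = root⇒∈⟨g⟩ (^-∣ ε m ε^m≡1 (m∣m*n n))

  ξ∈⟨g⟩ : ξ ∈⟨g⟩
  ξ∈⟨g⟩ = root⇒∈⟨g⟩ (^-∣ ξ n ξ^n≡1 (n∣m*n m))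

  E[A]⊆⟨g⟩ : ∀ {x} → x ∈E[A] → x ∈⟨g⟩
  E[A]⊆⟨g⟩ (i , j , refl) = ∈⟨g⟩-* (∈⟨g⟩-^ (toℕ i) ε∈⟨g⟩) (∈⟨g⟩-^ (toℕ j) ξ∈⟨g⟩)

  ⟨g⟩⊆E[A] : ∀ {x} → x ∈⟨g⟩ → x ∈E[A]
  ⟨g⟩⊆E[A] (k , refl) = fromℕ< (m%n<n k m) , fromℕ< (m%n<n k n) , (begin
    g ^ k                                       ≡⟨ ^-distrib-* ε ξ k ⟩
    ε ^ k * ξ ^ k                               ≡⟨ sym (cong₂ _*_ (^-toFin ε m ε^m≡1 k)
                                                                  (^-toFin ξ n ξ^n≡1 k)) ⟩
    a (fromℕ< (m%n<n k m)) (fromℕ< (m%n<n k n)) ∎)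

  ρ₀-⟨g⟩ : ∀ {v} → v ∈⟨g⟩ → ρ₀ v ≡ - (ξ * v)
  ρ₀-⟨g⟩ = ρ₀-entry ∘ ⟨g⟩⊆E[A]

  ρ₀-−⟨g⟩ : ∀ {v} → v ∈⟨g⟩ → ρ₀ (- v) ≡ ε * v
  ρ₀-−⟨g⟩ {v} v∈ =
    trans (ρ₀-negEntry (-‿∉⟨g⟩ v∈ ∘ E[A]⊆⟨g⟩) (⟨g⟩⊆E[A] v∈′)) (cong (ε *_) (-‿involutive v))
    where
    v∈′ : - - v ∈⟨g⟩
    v∈′ = subst _∈⟨g⟩ (sym (-‿involutive v)) v∈

  ρ₀≢0 : ∀ {x} → ¬ x ≡ 0# → ¬ ρ₀ x ≡ 0#
  ρ₀≢0 {x} x≢0 with classify x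
  ... | null x≡0          = contradiction x≡0 x≢0
  ... | power k refl      = subst (λ y → ¬ y ≡ 0#) (sym (ρ₀-⟨g⟩ (k , refl)))
                              (-‿nonzero (*-nonzero (∈⟨g⟩⇒≢0 ξ∈⟨g⟩) (^-nonzero k g≢0)))
  ... | negPower k refl   = subst (λ y → ¬ y ≡ 0#) (sym (ρ₀-−⟨g⟩ (k , refl)))
                              (*-nonzero (∈⟨g⟩⇒≢0 ε∈⟨g⟩) (^-nonzero k g≢0))

  ρ₀-scale : ∀ {c x} → c ∈⟨g⟩ → ¬ x ≡ 0# → ρ₀ (c * x) ≡ c * ρ₀ x
  ρ₀-scale {c} {x} c∈ x≢0 with classify x
  ... | null x≡0 = contradiction x≡0 x≢0
  ... | power k refl = begin
    ρ₀ (c * g ^ k)        ≡⟨ ρ₀-⟨g⟩ (∈⟨g⟩-* c∈ (k , refl)) ⟩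
    - (ξ * (c * g ^ k))   ≡⟨ cong -_ (x∙yz≈y∙xz ξ c _) ⟩
    - (c * (ξ * g ^ k))   ≡⟨ -‿distribʳ-* c _ ⟩
    c * - (ξ * g ^ k)     ≡⟨ cong (c *_) (sym (ρ₀-⟨g⟩ (k , refl))) ⟩
    c * ρ₀ (g ^ k)        ∎
  ... | negPower k refl = begin
    ρ₀ (c * - g ^ k)      ≡⟨ cong ρ₀ (sym (-‿distribʳ-* c _)) ⟩
    ρ₀ (- (c * g ^ k))    ≡⟨ ρ₀-−⟨g⟩ (∈⟨g⟩-* c∈ (k , refl)) ⟩
    ε * (c * g ^ k)       ≡⟨ x∙yz≈y∙xz ε c _ ⟩
    c * (ε * g ^ k)       ≡⟨ cong (c *_) (sym (ρ₀-−⟨g⟩ (k , refl))) ⟩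
    c * ρ₀ (- g ^ k)      ∎

  ρ₀∘ρ₀ : ∀ {x} → ¬ x ≡ 0# → ρ₀ (ρ₀ x) ≡ g * x
  ρ₀∘ρ₀ {x} x≢0 with classify x
  ... | null x≡0 = contradiction x≡0 x≢0
  ... | power k refl = begin
    ρ₀ (ρ₀ (g ^ k))       ≡⟨ cong ρ₀ (ρ₀-⟨g⟩ (k , refl)) ⟩
    ρ₀ (- (ξ * g ^ k))    ≡⟨ ρ₀-−⟨g⟩ (∈⟨g⟩-* ξ∈⟨g⟩ (k , refl)) ⟩
    ε * (ξ * g ^ k)       ≡⟨ sym (*-assoc ε ξ _) ⟩
    g * g ^ k             ∎
  ... | negPower k refl = begin
    ρ₀ (ρ₀ (- g ^ k))     ≡⟨ cong ρ₀ (ρ₀-−⟨g⟩ (k , refl)) ⟩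
    ρ₀ (ε * g ^ k)        ≡⟨ ρ₀-⟨g⟩ (∈⟨g⟩-* ε∈⟨g⟩ (k , refl)) ⟩
    - (ξ * (ε * g ^ k))   ≡⟨ cong -_ (x∙yz≈y∙xz ξ ε _) ⟩
    - (ε * (ξ * g ^ k))   ≡⟨ cong -_ (sym (*-assoc ε ξ _)) ⟩
    - (g * g ^ k)         ≡⟨ -‿distribʳ-* g _ ⟩
    g * - g ^ k           ∎

  ρ₀-preimage : ∀ {y} → - y ∈⟨g⟩ → ∃ λ w → w ∈⟨g⟩ × ρ₀ w ≡ y
  ρ₀-preimage {y} -y∈ with ∈⟨g⟩-inverse ξ∈⟨g⟩
  ... | ξ⁻¹ , ξ⁻¹∈ , ξξ⁻¹≡1 = ξ⁻¹ * - y , ∈⟨g⟩-* ξ⁻¹∈ -y∈ , (begin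
    ρ₀ (ξ⁻¹ * - y)        ≡⟨ ρ₀-⟨g⟩ (∈⟨g⟩-* ξ⁻¹∈ -y∈) ⟩
    - (ξ * (ξ⁻¹ * - y))   ≡⟨ cong -_ (sym (*-assoc ξ ξ⁻¹ _)) ⟩
    - (ξ * ξ⁻¹ * - y)     ≡⟨ cong (λ t → - (t * - y)) ξξ⁻¹≡1 ⟩
    - (1# * - y)          ≡⟨ cong -_ (*-identityˡ _) ⟩
    - - y                 ≡⟨ -‿involutive y ⟩
    y                     ∎)

  scaling-isAut₀⁺ : ∀ {h} → h ∈⟨g⟩ → IsAut₀⁺ (h *_)
  scaling-isAut₀⁺ {h} h∈ = (*-cancelˡ (∈⟨g⟩⇒≢0 h∈) , surjective) , orientation , zeroʳ h
    where
    surjective : ∀ y → ∃ λ x → ∀ {z} → z ≡ x → h * z ≡ y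
    surjective y with h⁻¹ , _ , hh⁻¹≡1 ← ∈⟨g⟩-inverse h∈ = h⁻¹ * y , λ { refl → begin
      h * (h⁻¹ * y)  ≡⟨ sym (*-assoc h h⁻¹ y) ⟩
      h * h⁻¹ * y    ≡⟨ cong (_* y) hh⁻¹≡1 ⟩
      1# * y         ≡⟨ *-identityˡ y ⟩
      y              ∎ }
    orientation : OrientationPreserving (h *_)
    orientation x y x≢y = begin
      h * x + ρ₀ ((h * y) - (h * x)) ≡⟨ cong (λ t → h * x + ρ₀ t) (sym (x[y-z]≈xy-xz h y x)) ⟩
      h * x + ρ₀ (h * (y - x))       ≡⟨ cong (h * x +_) (ρ₀-scale h∈ (x≢y ∘ sym ∘ x-y≡0⇒x≡y)) ⟩
      h * x + h * ρ₀ (y - x)         ≡⟨ sym (distribˡ h x _) ⟩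
      h * (x + ρ₀ (y - x))           ∎

  module Automorphism {σ : Carrier → Carrier} (σ-aut : IsAut₀⁺ σ) where
    private
      σ-injective : Injective _≡_ _≡_ σ
      σ-injective = proj₁ (proj₁ σ-aut)
      σ-orientation : OrientationPreserving σ
      σ-orientation = proj₁ (proj₂ σ-aut)
      σ0≡0 : σ 0# ≡ 0#
      σ0≡0 = proj₂ (proj₂ σ-aut)

    c : Carrier
    c = σ 1#

    σ≢0 : ∀ {x} → ¬ x ≡ 0# → ¬ σ x ≡ 0#
    σ≢0 x≢0 σx≡0 = x≢0 (σ-injective (trans σx≡0 (sym σ0≡0)))

    c≢0 : ¬ c ≡ 0#
    c≢0 = σ≢0 (0≢1 ∘ sym)

    σ-ρ₀ : ∀ {y} → ¬ y ≡ 0# → ρ₀ (σ y) ≡ σ (ρ₀ y)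
    σ-ρ₀ {y} y≢0 = begin
      ρ₀ (σ y)                ≡⟨ sym (+-identityˡ _) ⟩
      0# + ρ₀ (σ y)           ≡⟨ cong₂ (λ s t → s + ρ₀ t) (sym σ0≡0) σy≡σy-σ0 ⟩
      σ 0# + ρ₀ (σ y - σ 0#)  ≡⟨ σ-orientation 0# y (y≢0 ∘ sym) ⟩
      σ (0# + ρ₀ (y - 0#))    ≡⟨ cong σ (trans (+-identityˡ _) (cong ρ₀ (x-0≡x y))) ⟩
      σ (ρ₀ y)                ∎
      where
      σy≡σy-σ0 : σ y ≡ σ y - σ 0#
      σy≡σy-σ0 = sym (trans (cong (λ t → σ y - t) σ0≡0) (x-0≡x (σ y)))

    σ-g* : ∀ {w} → ¬ w ≡ 0# → σ (g * w) ≡ g * σ w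
    σ-g* {w} w≢0 = begin
      σ (g * w)         ≡⟨ cong σ (sym (ρ₀∘ρ₀ w≢0)) ⟩
      σ (ρ₀ (ρ₀ w))     ≡⟨ sym (σ-ρ₀ (ρ₀≢0 w≢0)) ⟩
      ρ₀ (σ (ρ₀ w))     ≡⟨ cong ρ₀ (sym (σ-ρ₀ w≢0)) ⟩
      ρ₀ (ρ₀ (σ w))     ≡⟨ ρ₀∘ρ₀ (σ≢0 w≢0) ⟩
      g * σ w           ∎

    σ-⟨g⟩ : ∀ {v} → v ∈⟨g⟩ → σ v ≡ v * c
    σ-⟨g⟩ (k , refl) = σ-g^ k
      where
      σ-g^ : ∀ k → σ (g ^ k) ≡ g ^ k * c
      σ-g^ zero    = sym (*-identityˡ c)
      σ-g^ (suc k) = begin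
        σ (g * g ^ k)     ≡⟨ σ-g* (^-nonzero k g≢0) ⟩
        g * σ (g ^ k)     ≡⟨ cong (g *_) (σ-g^ k) ⟩
        g * (g ^ k * c)   ≡⟨ sym (*-assoc g _ c) ⟩
        g * g ^ k * c     ∎

    σ-ρ₀-⟨g⟩ : ∀ {v} → v ∈⟨g⟩ → σ (ρ₀ v) ≡ ρ₀ (v * c)
    σ-ρ₀-⟨g⟩ v∈ = trans (sym (σ-ρ₀ (∈⟨g⟩⇒≢0 v∈))) (cong ρ₀ (σ-⟨g⟩ v∈))

    c∈⟨g⟩⇒σ≡c* : c ∈⟨g⟩ → ∀ x → σ x ≡ c * x
    c∈⟨g⟩⇒σ≡c* c∈ x with classify x
    ... | null refl        = trans σ0≡0 (sym (zeroʳ c))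
    ... | power k refl     = trans (σ-⟨g⟩ (k , refl)) (*-comm _ c)
    ... | negPower k refl with ρ₀-preimage (k , -‿involutive _)
    ...   | w , w∈ , ρ₀w≡x = begin
      σ (- g ^ k)      ≡⟨ cong σ (sym ρ₀w≡x) ⟩
      σ (ρ₀ w)         ≡⟨ σ-ρ₀-⟨g⟩ w∈ ⟩
      ρ₀ (w * c)       ≡⟨ cong ρ₀ (*-comm w c) ⟩
      ρ₀ (c * w)       ≡⟨ ρ₀-scale c∈ (∈⟨g⟩⇒≢0 w∈) ⟩
      c * ρ₀ w         ≡⟨ cong (c *_) ρ₀w≡x ⟩
      c * - g ^ k      ∎

    ξσ-−⟨g⟩ : - c ∈⟨g⟩ → ∀ {y} → - y ∈⟨g⟩ → ξ * σ y ≡ ε * (y * c)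
    ξσ-−⟨g⟩ -c∈ {y} -y∈ with ρ₀-preimage -y∈
    ... | w , w∈ , ρ₀w≡y = begin
      ξ * σ y              ≡⟨ cong (λ t → ξ * σ t) (sym ρ₀w≡y) ⟩
      ξ * σ (ρ₀ w)         ≡⟨ cong (ξ *_) (σ-ρ₀-⟨g⟩ w∈) ⟩
      ξ * ρ₀ (w * c)       ≡⟨ cong (λ t → ξ * ρ₀ t) (sym (-x*-y≡x*y w c)) ⟩
      ξ * ρ₀ (- w * - c)   ≡⟨ cong (λ t → ξ * ρ₀ t) (sym (-‿distribˡ-* w (- c))) ⟩
      ξ * ρ₀ (- (w * - c)) ≡⟨ cong (ξ *_) (ρ₀-−⟨g⟩ (∈⟨g⟩-* w∈ -c∈)) ⟩
      ξ * (ε * (w * - c))  ≡⟨ x∙yz≈y∙xz ξ ε _ ⟩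
      ε * (ξ * (w * - c))  ≡⟨ cong (ε *_) (sym (*-assoc ξ w _)) ⟩
      ε * (ξ * w * - c)    ≡⟨ cong (λ t → ε * (t * - c)) ξw≡-y ⟩
      ε * (- y * - c)      ≡⟨ cong (ε *_) (-x*-y≡x*y y c) ⟩
      ε * (y * c)          ∎
      where
      ξw≡-y : ξ * w ≡ - y
      ξw≡-y = trans (sym (-‿involutive _)) (cong -_ (trans (sym (ρ₀-⟨g⟩ w∈)) ρ₀w≡y))

    -- orientation-preservation at the edge from 1 to 1 + d
    σ[1-ξd] : - c ∈⟨g⟩ → ∀ {d} → d ∈⟨g⟩ → 1# + d ∈⟨g⟩ →
              σ (1# - (ξ * d)) ≡ (1# - (ε * d)) * c
    σ[1-ξd] -c∈ {d} d∈ 1+d∈ = begin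
      σ (1# - (ξ * d))               ≡⟨ cong (λ t → σ (1# + t)) (sym (ρ₀-⟨g⟩ d∈)) ⟩
      σ (1# + ρ₀ d)                  ≡⟨ cong (λ t → σ (1# + ρ₀ t)) (sym (xyx⁻¹≈y 1# d)) ⟩
      σ (1# + ρ₀ ((1# + d) - 1#))    ≡⟨ sym (σ-orientation 1# (1# + d) 1≢1+d) ⟩
      c + ρ₀ (σ (1# + d) - c)        ≡⟨ cong (λ t → c + ρ₀ t) σ[1+d]-c≡dc ⟩
      c + ρ₀ (d * c)                 ≡⟨ cong (λ t → c + ρ₀ t) (sym (-x*-y≡x*y d c)) ⟩
      c + ρ₀ (- d * - c)             ≡⟨ cong (λ t → c + ρ₀ t) (sym (-‿distribˡ-* d (- c))) ⟩
      c + ρ₀ (- (d * - c))           ≡⟨ cong (c +_) (ρ₀-−⟨g⟩ (∈⟨g⟩-* d∈ -c∈)) ⟩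
      c + ε * (d * - c)              ≡⟨ cong₂ _+_ (sym (*-identityˡ c)) ε[d*-c]≡-[εd]*c ⟩
      1# * c + - (ε * d) * c         ≡⟨ sym (distribʳ c 1# _) ⟩
      (1# - (ε * d)) * c             ∎
      where
      1≢1+d : ¬ 1# ≡ 1# + d
      1≢1+d 1≡1+d =
        ∈⟨g⟩⇒≢0 d∈ (+-cancelˡ 1# d 0# (trans (sym 1≡1+d) (sym (+-identityʳ 1#))))
      σ[1+d]-c≡dc : σ (1# + d) - c ≡ d * c
      σ[1+d]-c≡dc = begin
        σ (1# + d) - c          ≡⟨ cong (_- c) (σ-⟨g⟩ 1+d∈) ⟩
        ((1# + d) * c) - c      ≡⟨ cong (_- c) (distribʳ c 1# d) ⟩
        (1# * c + d * c) - c    ≡⟨ cong (λ t → (t + d * c) - c) (*-identityˡ c) ⟩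
        (c + d * c) - c         ≡⟨ xyx⁻¹≈y c (d * c) ⟩
        d * c                   ∎
      ε[d*-c]≡-[εd]*c : ε * (d * - c) ≡ - (ε * d) * c
      ε[d*-c]≡-[εd]*c = begin
        ε * (d * - c)     ≡⟨ sym (*-assoc ε d _) ⟩
        ε * d * - c       ≡⟨ sym (-‿distribʳ-* _ c) ⟩
        - (ε * d * c)     ≡⟨ -‿distribˡ-* _ c ⟩
        - (ε * d) * c     ∎

    -c∉⟨g⟩ : ¬ - c ∈⟨g⟩
    -c∉⟨g⟩ -c∈ with d , d∈ , 1+d∈ ← ∃[d]1+d∈⟨g⟩ mn≢1 =
      ε≢ξ (ε≡ξ (classify (1# - (ξ * d))))
      where
      σz≡ : σ (1# - (ξ * d)) ≡ (1# - (ε * d)) * c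
      σz≡ = σ[1-ξd] -c∈ d∈ 1+d∈
      ε≡ξ : Classification (1# - (ξ * d)) → ε ≡ ξ
      ε≡ξ (null z≡0) = *-cancelʳ (∈⟨g⟩⇒≢0 d∈) (a-x≡a-y⇒x≡y (trans 1-εd≡0 (sym z≡0)))
        where
        1-εd≡0 : 1# - (ε * d) ≡ 0#
        1-εd≡0 = *-cancelʳ c≢0 (begin
          (1# - (ε * d)) * c   ≡⟨ sym σz≡ ⟩
          σ (1# - (ξ * d))     ≡⟨ cong σ z≡0 ⟩
          σ 0#                 ≡⟨ σ0≡0 ⟩
          0#                   ≡⟨ sym (zeroˡ c) ⟩
          0# * c               ∎)
      ε≡ξ (power k z≡g^k) =
        *-cancelʳ (∈⟨g⟩⇒≢0 d∈) (a-x≡a-y⇒x≡y (*-cancelʳ c≢0 (trans (sym σz≡) σz≡zc)))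
        where
        σz≡zc : σ (1# - (ξ * d)) ≡ (1# - (ξ * d)) * c
        σz≡zc = σ-⟨g⟩ (k , z≡g^k)
      ε≡ξ (negPower k z≡-g^k) = sym (x[1-yd]≡y[1-xd]⇒x≡y (*-cancelʳ c≢0 (begin
        ξ * (1# - (ε * d)) * c     ≡⟨ *-assoc ξ _ c ⟩
        ξ * ((1# - (ε * d)) * c)   ≡⟨ cong (ξ *_) (sym σz≡) ⟩
        ξ * σ (1# - (ξ * d))       ≡⟨ ξσ-−⟨g⟩ -c∈ -z∈ ⟩
        ε * ((1# - (ξ * d)) * c)   ≡⟨ sym (*-assoc ε _ c) ⟩
        ε * (1# - (ξ * d)) * c     ∎)))
        where
        -z∈ : - (1# - (ξ * d)) ∈⟨g⟩
        -z∈ = k , trans (cong -_ z≡-g^k) (-‿involutive _)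

    σ-is-scaling : ∃ λ (k : Fin (m ℕ.* n)) → ∀ x → g ^ toℕ k * x ≡ σ x
    σ-is-scaling with classify c
    ... | null c≡0          = contradiction c≡0 c≢0
    ... | power s c≡g^s     = toFin s , λ x → begin
      g ^ toℕ (toFin s) * x   ≡⟨ cong (_* x) (trans (g^toFin s) (sym c≡g^s)) ⟩
      c * x                   ≡⟨ sym (c∈⟨g⟩⇒σ≡c* (s , c≡g^s) x) ⟩
      σ x                     ∎
    ... | negPower s c≡-g^s = contradiction (s , trans (cong -_ c≡-g^s) (-‿involutive _)) -c∉⟨g⟩

  φ : Fin (m ℕ.* n) → Carrier → Carrier
  φ k x = g ^ toℕ k * x

  φ-isAut₀⁺ : ∀ k → IsAut₀⁺ (φ k)
  φ-isAut₀⁺ k = scaling-isAut₀⁺ (toℕ k , refl)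

  φ-injective : ∀ k l → (∀ x → φ k x ≡ φ l x) → k ≡ l
  φ-injective k l φk≗φl =
    g^-injective (trans (sym (*-identityʳ _)) (trans (φk≗φl 1#) (*-identityʳ _)))

  φ-surjective : ∀ σ → IsAut₀⁺ σ → ∃ λ k → ∀ x → φ k x ≡ σ x
  φ-surjective σ σ-aut = Automorphism.σ-is-scaling σ-aut

  φ-homomorphic : ∀ k l x → φ (k +ₘ l) x ≡ φ k (φ l x)
  φ-homomorphic k l x = trans (cong (_* x) (^-+ₘ g g^N≡1 k l)) (*-assoc _ _ x)

open import Data.Nat using (_+_; _*_; _<_)
open FiniteField using (Carrier; HasOrder)

proposition3p4 : (m n q : ℕ) → 0 < m → 0 < n → ¬ (2 ∣ m) → ¬ (2 ∣ n) → Coprime m n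
    → q ≡ suc (2 * m * n) → IsPrimePower q
    → (F : FiniteField q) (ξ ε : Carrier F)
    → HasOrder F ξ n → HasOrder F ε m
    → Archdeacon.RowsColsSumZero F m n ε ξ
    → Archdeacon.Aut₀⁺≅ℤ F m n ε ξ (m * n)
proposition3p4 m n q _ 0<n 2∤m 2∤n m⊥n q≡1+2mn _ F ξ ε ord-ξ ord-ε (_ , columns≡0) =
  φ , φ-isAut₀⁺ , φ-injective , φ-surjective , φ-homomorphic
  where
  open CyclicArchdeacon F ord-ε ord-ξ m⊥n (trans q≡1+2mn (cong suc (ℕ.*-assoc 2 m n)))
    (odd*odd 2∤m 2∤n) (columnSumZero⇒m≢1 F 0<n columns≡0)
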